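{- Let $G$ be a finite graph and let $G'$ be obtained from $G$ by adding a leaf-twig configuration at some vertex $v$ of $G$. Then $G'$ has a difference-1 colouring if and only if $G$ has a difference-1 colouring.
   Context: A colouring of a graph is a map from its edges to $\{\text{blue},\text{red}\}$; it is a difference-1 colouring if at every vertex the number of incident blue edges minus the number of incident red edges equals $1$. Adding a leaf-twig configuration at $v$ means adding four new vertices $\ell, b, \ell_1, \ell_2$ and the four edges $v\ell$, $vb$, $b\ell_1$, $b\ell_2$ (so $\ell,\ell_1,\ell_2$ are leaves and $b$ has degree $3$). -}

module Defs where

open import Data.Nat using (ℕ; zero; suc; _+_)
open import Data.Fin using (Fin; zero; suc; _↑ˡ_; _↑ʳ_)
open import Data.Integer using (ℤ; 0ℤ; 1ℤ; -1ℤ) renaming (_+_ to _+ℤ_)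
open import Data.List using (List; []; _∷_; _++_; length; lookup; map)
open import Data.List.Relation.Unary.All using (All)
open import Data.List.Relation.Unary.AllPairs using (AllPairs)
open import Data.Product using (_×_; _,_; ∃)
open import Data.Sum using (_⊎_)
open import Relation.Binary.PropositionalEquality using (_≡_; _≢_)
open import Relation.Nullary using (¬_; Dec; yes; no)
open import Data.Fin using (_≟_)

-- An edge of a graph on vertex set Fin n: an (unordered) pair of endpoints.
Edge : ℕ → Set
Edge n = Fin n × Fin n

SameEdge : ∀ {n} → Edge n → Edge n → Set
SameEdge (a , b) (c , d) = ((a ≡ c) × (b ≡ d)) ⊎ ((a ≡ d) × (b ≡ c))

record Graph : Set where
  constructor graph
  field
    n     : ℕ
    edges : List (Edge n)
open Graph public

IsSimple : Graph → Set
IsSimple G = All (λ e → Data.Product.proj₁ e ≢ Data.Product.proj₂ e) (edges G)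
           × AllPairs (λ e f → ¬ SameEdge e f) (edges G)

data Colour : Set where
  blue red : Colour

-- A colouring assigns a colour to each edge (edges indexed by position).
Colouring : Graph → Set
Colouring G = Fin (length (edges G)) → Colour

sign : Colour → ℤ
sign blue = 1ℤ
sign red  = -1ℤ

sumℤ : ∀ m → (Fin m → ℤ) → ℤ
sumℤ zero    f = 0ℤ
sumℤ (suc m) f = f zero +ℤ sumℤ m (λ i → f (suc i))

contrib : ∀ {n} → Edge n → Fin n → Colour → ℤ
contrib (a , b) v c with a ≟ v | b ≟ v
... | yes _ | _     = sign c
... | no _  | yes _ = sign c
... | no _  | no _  = 0ℤ

difference : (G : Graph) → Colouring G → Fin (n G) → ℤ
difference G c v =
  sumℤ (length (edges G)) (λ k → contrib (lookup (edges G) k) v (c k))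

IsDifference1 : (G : Graph) → Colouring G → Set
IsDifference1 G c = ∀ v → difference G c v ≡ 1ℤ

HasDifference1Colouring : Graph → Set
HasDifference1Colouring G = ∃ λ (c : Colouring G) → IsDifference1 G c

-- Adding a leaf-twig configuration at v: new vertices
-- ℓ = n, b = n+1, ℓ₁ = n+2, ℓ₂ = n+3 and edges vℓ, vb, bℓ₁, bℓ₂.
addLeafTwig : (G : Graph) → Fin (n G) → Graph
addLeafTwig (graph n E) v =
  graph (n + 4)
    (map (λ { (a , b) → (a ↑ˡ 4 , b ↑ˡ 4) }) E
      ++ (v' , ℓ) ∷ (v' , b) ∷ (b , ℓ₁) ∷ (b , ℓ₂) ∷ [])
  where
    v' = v ↑ˡ 4
    ℓ  = n ↑ʳ zero
    b  = n ↑ʳ (suc zero)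
    ℓ₁ = n ↑ʳ (suc (suc zero))
    ℓ₂ = n ↑ʳ (suc (suc (suc zero)))

-- A leaf forces its edge to be blue, so in a difference-1 colouring the edges vℓ, bℓ₁, bℓ₂ are
-- blue, and then b (blue + blue + colour of vb = 1) forces vb to be red. Hence the configuration
-- contributes +1 − 1 = 0 at v, and removing it, or adding it with exactly this colouring, leaves
-- the difference at every vertex of G unchanged.
module Submission where

open import Defs
open import Data.Fin using (Fin)
open import Function.Bundles using (_⇔_)

open import Data.Nat using (ℕ; suc; _+_)
open import Data.Fin using (zero; suc; _↑ˡ_; _↑ʳ_; #_; cast; splitAt; join; _≟_)
open import Data.Fin.Properties
  using (↑ˡ-injective; ↑ʳ-injective; splitAt-↑ˡ; splitAt-↑ʳ; cast-involutive; cast-is-id; join-splitAt)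
open import Data.Integer using (ℤ; 0ℤ; 1ℤ) renaming (_+_ to _+ℤ_)
open import Data.Integer.Properties using (+-assoc; +-identityˡ; +-identityʳ)
open import Data.List using (List; []; _∷_; _++_; length; map)
open import Data.List.Properties using (length-++; length-map)
open import Data.Product using (_,_)
open import Data.Sum using (inj₁; inj₂; [_,_])
open import Data.Empty using (⊥-elim)
open import Function using (_∘_)
open import Function.Bundles using (mk⇔; Equivalence)
open import Function.Definitions using (Injective)
open import Relation.Binary.PropositionalEquality using (_≡_; _≢_; refl; sym; trans; cong; cong₂; subst; module ≡-Reasoning)
open import Relation.Nullary using (yes; no)

private
  variable
    k m m′ : ℕ

balance : (E : List (Edge m)) → (Fin (length E) → Colour) → Fin m → ℤ
balance {m} E = difference (graph m E)

balance-cong : ∀ (E : List (Edge m)) {c d} → (∀ i → c i ≡ d i) → ∀ w → balance E c w ≡ balance E d w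
balance-cong []      h w = refl
balance-cong (e ∷ E) h w = cong₂ _+ℤ_ (cong (contrib e w) (h zero)) (balance-cong E (h ∘ suc) w)

contrib-non-incident : ∀ {a b w : Fin m} col → a ≢ w → b ≢ w → contrib (a , b) w col ≡ 0ℤ
contrib-non-incident {a = a} {b} {w} col a≢w b≢w with a ≟ w | b ≟ w
... | yes a≡w | _       = ⊥-elim (a≢w a≡w)
... | no _    | yes b≡w = ⊥-elim (b≢w b≡w)
... | no _    | no _    = refl

contrib-resp : ∀ {a b w : Fin m} {a′ b′ w′ : Fin m′} col →
  (a ≡ w ⇔ a′ ≡ w′) → (b ≡ w ⇔ b′ ≡ w′) → contrib (a , b) w col ≡ contrib (a′ , b′) w′ col
contrib-resp {a = a} {b} {w} {a′} {b′} {w′} col p q with a ≟ w | b ≟ w | a′ ≟ w′ | b′ ≟ w′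
... | yes _ | _     | yes _   | _       = refl
... | yes e | _     | no ne   | _       = ⊥-elim (ne (Equivalence.to p e))
... | no ne | _     | yes e   | _       = ⊥-elim (ne (Equivalence.from p e))
... | no _  | yes _ | no _    | yes _   = refl
... | no _  | yes e | no _    | no ne   = ⊥-elim (ne (Equivalence.to q e))
... | no _  | no ne | no _    | yes e   = ⊥-elim (ne (Equivalence.from q e))
... | no _  | no _  | no _    | no _    = refl

mapEdge : (Fin m → Fin m′) → Edge m → Edge m′
mapEdge ι (a , b) = ι a , ι b

module _ (ι : Fin m → Fin m′) where

  restrictMap : (E : List (Edge m)) {A : Set} →
    (Fin (length (map (mapEdge ι) E)) → A) → Fin (length E) → A
  restrictMap E c = c ∘ cast (sym (length-map (mapEdge ι) E))

  extendMap : (E : List (Edge m)) {A : Set} →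
    (Fin (length E) → A) → Fin (length (map (mapEdge ι) E)) → A
  extendMap E d = d ∘ cast (length-map (mapEdge ι) E)

  restrictMap-extendMap : ∀ E {A : Set} (d : Fin (length E) → A) i → restrictMap E (extendMap E d) i ≡ d i
  restrictMap-extendMap E d i = cong d (cast-involutive (length-map (mapEdge ι) E) (sym (length-map (mapEdge ι) E)) i)

  balance-map : Injective _≡_ _≡_ ι → ∀ E c u →
    balance (map (mapEdge ι) E) c (ι u) ≡ balance E (restrictMap E c) u
  balance-map inj []            c u = refl
  balance-map inj ((a , b) ∷ E) c u = cong₂ _+ℤ_
    (contrib-resp (c zero) (mk⇔ inj (cong ι)) (mk⇔ inj (cong ι)))
    (balance-map inj E (c ∘ suc) u)

  balance-map-outside : ∀ {w} → (∀ a → ι a ≢ w) → ∀ E c → balance (map (mapEdge ι) E) c w ≡ 0ℤ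
  balance-map-outside ι≢w []            c = refl
  balance-map-outside ι≢w ((a , b) ∷ E) c = cong₂ _+ℤ_
    (contrib-non-incident (c zero) (ι≢w a) (ι≢w b))
    (balance-map-outside ι≢w E (c ∘ suc))

module _ {A : Set} (xs ys : List A) where

  injectˡ : Fin (length xs) → Fin (length (xs ++ ys))
  injectˡ i = cast (sym (length-++ xs)) (i ↑ˡ length ys)

  injectʳ : Fin (length ys) → Fin (length (xs ++ ys))
  injectʳ j = cast (sym (length-++ xs)) (length xs ↑ʳ j)

  append : {B : Set} → (Fin (length xs) → B) → (Fin (length ys) → B) → Fin (length (xs ++ ys)) → B
  append f g = [ f , g ] ∘ splitAt (length xs) ∘ cast (length-++ xs)

  append-injectˡ : ∀ {B : Set} (f : Fin (length xs) → B) g i → append f g (injectˡ i) ≡ f i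
  append-injectˡ f g i = trans
    (cong ([ f , g ] ∘ splitAt (length xs)) (cast-involutive (length-++ xs) (sym (length-++ xs)) _))
    (cong [ f , g ] (splitAt-↑ˡ _ i _))

  append-injectʳ : ∀ {B : Set} (f : Fin (length xs) → B) g j → append f g (injectʳ j) ≡ g j
  append-injectʳ f g j = trans
    (cong ([ f , g ] ∘ splitAt (length xs)) (cast-involutive (length-++ xs) (sym (length-++ xs)) _))
    (cong [ f , g ] (splitAt-↑ʳ _ _ j))

balance-++ : ∀ (xs ys : List (Edge m)) c w →
  balance (xs ++ ys) c w ≡ balance xs (c ∘ injectˡ xs ys) w +ℤ balance ys (c ∘ injectʳ xs ys) w
balance-++ []       ys c w =
  trans (balance-cong ys (λ j → cong c (sym (cast-is-id _ j))) w) (sym (+-identityˡ _))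
balance-++ (x ∷ xs) ys c w = trans
  (cong (contrib x w (c zero) +ℤ_) (balance-++ xs ys (c ∘ suc) w))
  (sym (+-assoc (contrib x w (c zero)) _ _))

↑-elim : ∀ (P : Fin (m + k) → Set) → (∀ u → P (u ↑ˡ k)) → (∀ j → P (m ↑ʳ j)) → ∀ w → P w
↑-elim {m} {k} P left right w = subst P (join-splitAt m k w) (by-side (splitAt m w))
  where
  by-side : ∀ s → P (join m k s)
  by-side (inj₁ u) = left u
  by-side (inj₂ j) = right j

↑ˡ≢↑ʳ : ∀ (i : Fin m) (j : Fin k) → i ↑ˡ k ≢ m ↑ʳ j
↑ˡ≢↑ʳ {m} {k} i j eq with trans (sym (splitAt-↑ˡ m i k)) (trans (cong (splitAt m) eq) (splitAt-↑ʳ m k j))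
... | ()

graft : Fin m → Fin (suc k) → Fin (m + k)
graft {k = k} v zero    = v ↑ˡ k
graft {m}     v (suc j) = m ↑ʳ j

graft-injective : ∀ (v : Fin m) → Injective _≡_ _≡_ (graft {k = k} v)
graft-injective v {zero}  {zero}  _  = refl
graft-injective v {zero}  {suc j} eq = ⊥-elim (↑ˡ≢↑ʳ v j eq)
graft-injective v {suc i} {zero}  eq = ⊥-elim (↑ˡ≢↑ʳ v i (sym eq))
graft-injective {m} v {suc i} {suc j} eq = cong suc (↑ʳ-injective m i j eq)

glue : (G : Graph) → Fin (n G) → List (Edge (suc k)) → Graph
glue {k} (graph m E) v H = graph (m + k) (map (mapEdge (_↑ˡ k)) E ++ map (mapEdge (graft v)) H)

IsDifference1OffRoot : (H : List (Edge (suc k))) → (Fin (length H) → Colour) → Set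
IsDifference1OffRoot H c = ∀ j → balance H c (suc j) ≡ 1ℤ

module _ (E : List (Edge m)) (v : Fin m) (H : List (Edge (suc k))) where

  private
    old = map (mapEdge (_↑ˡ k)) E
    new = map (mapEdge (graft v)) H

  restrictOld : Colouring (glue (graph m E) v H) → Colouring (graph m E)
  restrictOld c = restrictMap (_↑ˡ k) E (c ∘ injectˡ old new)

  restrictNew : Colouring (glue (graph m E) v H) → Fin (length H) → Colour
  restrictNew c = restrictMap (graft v) H (c ∘ injectʳ old new)

  glueColourings : Colouring (graph m E) → (Fin (length H) → Colour) → Colouring (glue (graph m E) v H)
  glueColourings cE cH = append old new (extendMap (_↑ˡ k) E cE) (extendMap (graft v) H cH)

  restrictOld-glueColourings : ∀ cE cH i → restrictOld (glueColourings cE cH) i ≡ cE i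
  restrictOld-glueColourings cE cH i = trans
    (append-injectˡ old new (extendMap (_↑ˡ k) E cE) _ _)
    (restrictMap-extendMap (_↑ˡ k) E cE i)

  restrictNew-glueColourings : ∀ cE cH i → restrictNew (glueColourings cE cH) i ≡ cH i
  restrictNew-glueColourings cE cH i = trans
    (append-injectʳ old new (extendMap (_↑ˡ k) E cE) _ _)
    (restrictMap-extendMap (graft v) H cH i)

  balance-glue-new : ∀ c j → balance (old ++ new) c (m ↑ʳ j) ≡ balance H (restrictNew c) (suc j)
  balance-glue-new c j = begin
    balance (old ++ new) c (m ↑ʳ j)
      ≡⟨ balance-++ old new c (m ↑ʳ j) ⟩
    balance old _ (m ↑ʳ j) +ℤ balance new _ (graft v (suc j))
      ≡⟨ cong₂ _+ℤ_ (balance-map-outside (_↑ˡ k) (λ a → ↑ˡ≢↑ʳ a j) E _)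
                    (balance-map (graft v) (graft-injective v) H _ (suc j)) ⟩
    0ℤ +ℤ balance H (restrictNew c) (suc j)
      ≡⟨ +-identityˡ _ ⟩
    balance H (restrictNew c) (suc j) ∎
    where open ≡-Reasoning

  balance-new-at-old : ∀ d u → balance H (restrictMap (graft v) H d) zero ≡ 0ℤ → balance new d (u ↑ˡ k) ≡ 0ℤ
  balance-new-at-old d u root≡0 with v ≟ u
  ... | yes refl = trans (balance-map (graft v) (graft-injective v) H d zero) root≡0
  ... | no v≢u   = balance-map-outside (graft v) outside H d
    where
    outside : ∀ a → graft v a ≢ u ↑ˡ k
    outside zero    eq = v≢u (↑ˡ-injective k v u eq)
    outside (suc j) eq = ↑ˡ≢↑ʳ u j (sym eq)

  balance-glue-old : ∀ c u → balance H (restrictNew c) zero ≡ 0ℤ →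
    balance (old ++ new) c (u ↑ˡ k) ≡ balance E (restrictOld c) u
  balance-glue-old c u root≡0 = begin
    balance (old ++ new) c (u ↑ˡ k)
      ≡⟨ balance-++ old new c (u ↑ˡ k) ⟩
    balance old _ (u ↑ˡ k) +ℤ balance new _ (u ↑ˡ k)
      ≡⟨ cong₂ _+ℤ_ (balance-map (_↑ˡ k) (λ {i} {j} → ↑ˡ-injective k i j) E _ u)
                    (balance-new-at-old _ u root≡0) ⟩
    balance E (restrictOld c) u +ℤ 0ℤ
      ≡⟨ +-identityʳ _ ⟩
    balance E (restrictOld c) u ∎
    where open ≡-Reasoning

glue-difference1⇔ : ∀ (H : List (Edge (suc k))) →
  (∀ c → IsDifference1OffRoot H c → balance H c zero ≡ 0ℤ) →
  ∀ c₀ → IsDifference1OffRoot H c₀ → balance H c₀ zero ≡ 0ℤ →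
  ∀ G v → HasDifference1Colouring (glue G v H) ⇔ HasDifference1Colouring G
glue-difference1⇔ {k} H rootNeutral c₀ offRoot₀ root₀ (graph m E) v = mk⇔ restrict extend
  where
  restrict : HasDifference1Colouring (glue (graph m E) v H) → HasDifference1Colouring (graph m E)
  restrict (c , d1) =
    restrictOld E v H c , λ u → trans (sym (balance-glue-old E v H c u newRoot≡0)) (d1 (u ↑ˡ k))
    where
    newRoot≡0 : balance H (restrictNew E v H c) zero ≡ 0ℤ
    newRoot≡0 = rootNeutral _ λ j → trans (sym (balance-glue-new E v H c j)) (d1 (m ↑ʳ j))

  extend : HasDifference1Colouring (graph m E) → HasDifference1Colouring (glue (graph m E) v H)
  extend (cE , d1) = c , ↑-elim (λ w → difference (glue (graph m E) v H) c w ≡ 1ℤ) atOld atNew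
    where
    c = glueColourings E v H cE c₀
    newRoot≡0 : balance H (restrictNew E v H c) zero ≡ 0ℤ
    newRoot≡0 = trans (balance-cong H (restrictNew-glueColourings E v H cE c₀) zero) root₀
    atOld : ∀ u → difference (glue (graph m E) v H) c (u ↑ˡ k) ≡ 1ℤ
    atOld u = trans (balance-glue-old E v H c u newRoot≡0)
      (trans (balance-cong E (restrictOld-glueColourings E v H cE c₀) u) (d1 u))
    atNew : ∀ j → difference (glue (graph m E) v H) c (m ↑ʳ j) ≡ 1ℤ
    atNew j = trans (balance-glue-new E v H c j)
      (trans (balance-cong H (restrictNew-glueColourings E v H cE c₀) (suc j)) (offRoot₀ j))

-- Vertex 0 is glued to v; 1, 2, 3, 4 are ℓ, b, ℓ₁, ℓ₂, so that glue G v twig is addLeafTwig G v.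
twig : List (Edge 5)
twig = (# 0 , # 1) ∷ (# 0 , # 2) ∷ (# 2 , # 3) ∷ (# 2 , # 4) ∷ []

twig-rootNeutral : ∀ c → IsDifference1OffRoot twig c → balance twig c zero ≡ 0ℤ
twig-rootNeutral c d1 with c (# 0) | c (# 1) | c (# 2) | c (# 3) | d1 (# 0) | d1 (# 1) | d1 (# 2) | d1 (# 3)
... | blue | red  | blue | blue | _  | _  | _  | _  = refl
... | red  | _    | _    | _    | () | _  | _  | _
... | _    | _    | red  | _    | _  | _  | () | _
... | _    | _    | _    | red  | _  | _  | _  | ()
... | _    | blue | blue | blue | _  | () | _  | _

twigColouring : Fin 4 → Colour
twigColouring zero          = blue
twigColouring (suc zero)    = red
twigColouring (suc (suc _)) = blue

twigColouring-offRoot : IsDifference1OffRoot twig twigColouring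
twigColouring-offRoot zero                   = refl
twigColouring-offRoot (suc zero)             = refl
twigColouring-offRoot (suc (suc zero))       = refl
twigColouring-offRoot (suc (suc (suc zero))) = refl

mainTheorem11 : (G : Graph) → IsSimple G → (v : Fin (n G)) →
    HasDifference1Colouring (addLeafTwig G v) ⇔ HasDifference1Colouring G
mainTheorem11 G _ v =
  glue-difference1⇔ twig twig-rootNeutral twigColouring twigColouring-offRoot refl G v
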